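{- For every $\delta>0$ (as below) and any two configurations $C_1,C_2$ of $k$ servers on the line or on the circle, and every index $i$: if the point $\mathcal{P}^\delta_{C_1}[i]$ is located between two adjacent servers of $C_1$, then $D^{\min}_{C_1}(\mathcal{P}^\delta_{C_1}[i])\le k\cdot D^{\min}_{C_2}(\mathcal{P}^\delta_{C_2}[i])$.
   Context: The line $[0,1]$ (resp. circle of circumference 1) is discretized into equally spaced points at distance $\delta>0$, with $\delta$ chosen so that the points at positions $i/(2k)$, $i=0,\dots,2k$, are among them. A configuration is a placement of $k$ servers on $k$ distinct points. For a point $p$, $D^{\min}_C(p)$ is the distance from $p$ to the nearest server of $C$. $\mathcal{P}^\delta_C$ is the sequence of all points ordered by nondecreasing $D^{\min}_C$ (ties broken arbitrarily), and $\mathcal{P}^\delta_C[i]$ its $i$-th element. -}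

module Defs where

open import Data.Nat using (ℕ; zero; suc; _+_; _*_; _∸_; _≤_; _<_; _⊓_; ∣_-_∣; _≤ᵇ_)
open import Data.Bool using (if_then_else_)
open import Data.Fin using (Fin; toℕ) renaming (zero to fz; suc to fs)
import Data.Fin as F
open import Data.Product using (_,_)
open import Data.Product using (Σ; _×_; ∃-syntax)
open import Relation.Nullary using (¬_)
open import Function.Definitions using (Injective; Bijective)
open import Relation.Binary.PropositionalEquality using (_≡_)

-- Everything is measured in units of δ = 1/N, where N = 2·k·m (m ≥ 1),
-- so that the points i/(2k) are grid points.

data Space : Set where
  line circle : Space

numPts : Space → ℕ → ℕ
numPts line   N = suc N
numPts circle N = N

dist : (sp : Space) (N : ℕ) → Fin (numPts sp N) → Fin (numPts sp N) → ℕ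
dist line   N p q = ∣ toℕ p - toℕ q ∣
dist circle N p q = ∣ toℕ p - toℕ q ∣ ⊓ (N ∸ ∣ toℕ p - toℕ q ∣)

Config : Space → ℕ → ℕ → Set
Config sp N k = Σ (Fin k → Fin (numPts sp N)) (λ f → Injective _≡_ _≡_ f)

minOver : ∀ {n} → (Fin (suc n) → ℕ) → ℕ
minOver {zero}  f = f fz
minOver {suc n} f = f fz ⊓ minOver (λ i → f (fs i))

Dmin : (sp : Space) (N k' : ℕ) → Config sp N (suc k') → Fin (numPts sp N) → ℕ
Dmin sp N k' (c , _) p = minOver (λ s → dist sp N p (c s))

-- an ordering 𝒫^δ_C: a bijective enumeration of all points with nondecreasing D^min
-- (ties broken arbitrarily)
IsOrdering : (sp : Space) (N k' : ℕ) → Config sp N (suc k') →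
             (Fin (numPts sp N) → Fin (numPts sp N)) → Set
IsOrdering sp N k' C σ =
  Bijective _≡_ _≡_ σ ×
  (∀ i j → i F.≤ j → Dmin sp N k' C (σ i) ≤ Dmin sp N k' C (σ j))

cw : (N : ℕ) → Fin N → Fin N → ℕ
cw N a b = if toℕ a ≤ᵇ toℕ b then toℕ b ∸ toℕ a else N ∸ (toℕ a ∸ toℕ b)

-- length of the clockwise arc from server s to server t (full circle if s = t)
arcLen : (N : ℕ) → Fin N → Fin N → ℕ
arcLen N a b with cw N a b
... | zero  = N
... | suc d = suc d

Between : (sp : Space) (N k : ℕ) → Config sp N k → Fin (numPts sp N) → Set
Between line N k (c , _) p =
  ∃[ s ] ∃[ t ]
    (toℕ (c s) < toℕ (c t)) ×
    (¬ (∃[ u ] (toℕ (c s) < toℕ (c u) × toℕ (c u) < toℕ (c t)))) ×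
    (toℕ (c s) ≤ toℕ p × toℕ p ≤ toℕ (c t))
Between circle N k (c , _) p =
  ∃[ s ] ∃[ t ]
    (¬ (∃[ u ] (0 < cw N (c s) (c u) × cw N (c s) (c u) < arcLen N (c s) (c t)))) ×
    (cw N (c s) p ≤ arcLen N (c s) (c t))

gridN : ℕ → ℕ → ℕ
gridN k' m' = 2 * suc k' * suc m'

module Submission where

-- Let d = Dmin C₁ (σ₁ i) > 0 and e = Dmin C₂ (σ₂ i), positions counted from 0.  The point σ₁ i
-- lies in a gap between adjacent servers of C₁ at distance ≥ d from both ends, so the gap has
-- length ≥ 2d and contains 2(d − 1) points at distance < d from C₁; together with the k servers
-- they all precede position i in the C₁-ordering, whence k + 2(d − 1) ≤ i.  Conversely the first
-- i + 1 points of the C₂-ordering all lie within e of their nearest server of C₂, and a server has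
-- at most 2e + 1 points within distance e, whence i + 1 ≤ k(2e + 1).  So d − 1 < k e.

open import Data.Bool using (true; false)
open import Data.Fin using (Fin; toℕ; fromℕ<; inject≤; splitAt; combine) renaming (zero to fz; suc to fs)
import Data.Fin as F
open import Data.Fin.Properties
  using ( toℕ-injective; toℕ-fromℕ<; toℕ-inject≤; inject≤-injective; toℕ<n; injective⇒≤
        ; join-splitAt; combine-injective)
open import Data.Nat
open import Data.Nat.Properties
open import Data.Nat.DivMod
open import Data.Product using (Σ-syntax; ∃-syntax; _×_; _,_; proj₁; proj₂)
open import Data.Sum using (_⊎_; inj₁; inj₂; [_,_]′)
import Data.Sum as Sum
open import Data.Vec.Functional using (_++_)
open import Function.Definitions using (Injective; Surjective)
open import Relation.Binary.PropositionalEquality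
open import Relation.Nullary using (yes; no; ofʸ; ofⁿ)
open import Relation.Nullary.Negation using (contradiction)

open import Defs

minOver-≤ : ∀ {n} (f : Fin (suc n) → ℕ) (s : Fin (suc n)) → minOver f ≤ f s
minOver-≤ {zero}  f fz     = ≤-refl
minOver-≤ {suc n} f fz     = m⊓n≤m _ _
minOver-≤ {suc n} f (fs s) = ≤-trans (m⊓n≤n _ _) (minOver-≤ (λ i → f (fs i)) s)

minOver-attained : ∀ {n} (f : Fin (suc n) → ℕ) → ∃[ s ] minOver f ≡ f s
minOver-attained {zero}  f = fz , refl
minOver-attained {suc n} f with ⊓-sel (f fz) (minOver (λ i → f (fs i)))
... | inj₁ eq = fz , eq
... | inj₂ eq with minOver-attained (λ i → f (fs i))
...   | s , eq′ = fs s , trans eq eq′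

Sorted : ∀ {n} → (Fin n → ℕ) → (Fin n → Fin n) → Set
Sorted f σ = ∀ i j → i F.≤ j → f (σ i) ≤ f (σ j)

DistinctBelow : ∀ {n} → (Fin n → ℕ) → ℕ → ℕ → Set
DistinctBelow {n} f v a = Σ[ g ∈ (Fin a → Fin n) ] Injective _≡_ _≡_ g × (∀ j → f (g j) < v)

InjectiveOn : ∀ {A B : Set} → (A → Set) → (A → B) → Set
InjectiveOn P g = ∀ {x y} → P x → P y → g x ≡ g y → x ≡ y

SublevelInjection : ∀ {n} → (Fin n → ℕ) → ℕ → ℕ → Set
SublevelInjection {n} f e m = Σ[ code ∈ (Fin n → Fin m) ] InjectiveOn (λ x → f x ≤ e) code

distinctBelow⇒≤rank : ∀ {n a} {f : Fin n → ℕ} {σ : Fin n → Fin n} →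
  Surjective _≡_ _≡_ σ → Sorted f σ → (i : Fin n) → DistinctBelow f (f (σ i)) a → a ≤ toℕ i
distinctBelow⇒≤rank {n} {a} {f} {σ} surj sorted i (g , g-inj , g<) = injective⇒≤ h-inj
  where
  preimage : Fin a → Fin n
  preimage j = proj₁ (surj (g j))

  σ∘preimage : ∀ j → σ (preimage j) ≡ g j
  σ∘preimage j = proj₂ (surj (g j)) refl

  preimage<i : ∀ j → toℕ (preimage j) < toℕ i
  preimage<i j = ≰⇒> λ i≤ → <⇒≱ (g< j)
    (subst (λ x → f (σ i) ≤ f x) (σ∘preimage j) (sorted i (preimage j) i≤))

  h : Fin a → Fin (toℕ i)
  h j = fromℕ< (preimage<i j)

  h-inj : Injective _≡_ _≡_ h
  h-inj {x} {y} eq = g-inj (begin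
    g x               ≡⟨ σ∘preimage x ⟨
    σ (preimage x)    ≡⟨ cong σ (toℕ-injective (begin
        toℕ (preimage x) ≡⟨ toℕ-fromℕ< (preimage<i x) ⟨
        toℕ (h x)        ≡⟨ cong toℕ eq ⟩
        toℕ (h y)        ≡⟨ toℕ-fromℕ< (preimage<i y) ⟩
        toℕ (preimage y) ∎)) ⟩
    σ (preimage y)    ≡⟨ σ∘preimage y ⟩
    g y               ∎)
    where open ≡-Reasoning

rank<sublevel : ∀ {n m} {f : Fin n → ℕ} {σ : Fin n → Fin n} →
  Injective _≡_ _≡_ σ → Sorted f σ → (i : Fin n) → SublevelInjection f (f (σ i)) m → toℕ i < m
rank<sublevel {n} {m} {f} {σ} σ-inj sorted i (code , code-inj) = injective⇒≤ h-inj
  where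
  i<n : suc (toℕ i) ≤ n
  i<n = toℕ<n i

  first : Fin (suc (toℕ i)) → Fin n
  first j = inject≤ j i<n

  first-≤ : ∀ j → f (σ (first j)) ≤ f (σ i)
  first-≤ j = sorted (first j) i (subst (_≤ toℕ i) (sym (toℕ-inject≤ j i<n)) (s≤s⁻¹ (toℕ<n j)))

  h : Fin (suc (toℕ i)) → Fin m
  h j = code (σ (first j))

  h-inj : Injective _≡_ _≡_ h
  h-inj {x} {y} eq = inject≤-injective i<n i<n x y (σ-inj (code-inj (first-≤ x) (first-≤ y) eq))

double-<⇒< : ∀ {m n} → m + m < n + n → m < n
double-<⇒< lt = ≰⇒> λ n≤m → <⇒≱ lt (+-mono-≤ n≤m n≤m)

rank-bound : ∀ {n k} {f₁ f₂ : Fin n → ℕ} {σ₁ σ₂ : Fin n → Fin n} →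
  Surjective _≡_ _≡_ σ₁ → Sorted f₁ σ₁ → Injective _≡_ _≡_ σ₂ → Sorted f₂ σ₂ →
  (∀ e → SublevelInjection f₂ e (k * suc (e + e))) → (i : Fin n) →
  (∀ d → f₁ (σ₁ i) ≡ suc d → DistinctBelow f₁ (suc d) (k + (d + d))) →
  f₁ (σ₁ i) ≤ k * f₂ (σ₂ i)
rank-bound {k = k} {f₁} {f₂} {σ₁} {σ₂} σ₁-surj sorted₁ σ₂-inj sorted₂ sublevel i distinct
  with f₁ (σ₁ i) in level
... | zero  = z≤n
... | suc d = double-<⇒< (+-cancelˡ-< k (d + d) (e′ + e′) (begin-strict
    k + (d + d)           ≤⟨ distinctBelow⇒≤rank {f = f₁} σ₁-surj sorted₁ i below ⟩
    toℕ i                 <⟨ rank<sublevel {f = f₂} σ₂-inj sorted₂ i (sublevel e) ⟩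
    k * suc (e + e)       ≡⟨ *-suc k (e + e) ⟩
    k + k * (e + e)       ≡⟨ cong (k +_) (*-distribˡ-+ k e e) ⟩
    k + (e′ + e′)         ∎))
  where
  open ≤-Reasoning
  e = f₂ (σ₂ i)
  e′ = k * e
  below : DistinctBelow f₁ (f₁ (σ₁ i)) (k + (d + d))
  below = subst (λ v → DistinctBelow f₁ v (k + (d + d))) (sym level) (distinct d refl)

record BallCoordinate {n} (d : Fin n → Fin n → ℕ) (e : ℕ) : Set where
  field
    offset           : Fin n → Fin n → ℕ
    offset-≤         : ∀ {x y} → d x y ≤ e → offset x y ≤ e + e
    offset-injective : ∀ {x x′ y} → d x y ≤ e → d x′ y ≤ e → offset x y ≡ offset x′ y → x ≡ x′

mod-injective-≤ : ∀ {b m m′} → m ≤ b → m′ ≤ b → m mod suc b ≡ m′ mod suc b → m ≡ m′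
mod-injective-≤ {b} {m} {m′} m≤b m′≤b eq = begin
  m             ≡⟨ m≤n⇒m%n≡m m≤b ⟨
  m % suc b     ≡⟨ toℕ-fromℕ< (m%n<n m (suc b)) ⟨
  toℕ (m mod suc b)  ≡⟨ cong toℕ eq ⟩
  toℕ (m′ mod suc b) ≡⟨ toℕ-fromℕ< (m%n<n m′ (suc b)) ⟩
  m′ % suc b    ≡⟨ m≤n⇒m%n≡m m′≤b ⟩
  m′            ∎
  where open ≡-Reasoning

nearest-sublevelInjection : ∀ {n k′ e} {d : Fin n → Fin n → ℕ} → BallCoordinate d e →
  (c : Fin (suc k′) → Fin n) →
  SublevelInjection (λ x → minOver (λ s → d x (c s))) e (suc k′ * suc (e + e))
nearest-sublevelInjection {n} {k′} {e} {d} B c = code , code-inj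
  where
  open BallCoordinate B

  nearest : Fin n → Fin (suc k′)
  nearest x = proj₁ (minOver-attained (λ s → d x (c s)))

  near : ∀ {x} → minOver (λ s → d x (c s)) ≤ e → d x (c (nearest x)) ≤ e
  near {x} = subst (_≤ e) (proj₂ (minOver-attained (λ s → d x (c s))))

  code : Fin n → Fin (suc k′ * suc (e + e))
  code x = combine (nearest x) (offset x (c (nearest x)) mod suc (e + e))

  code-inj : InjectiveOn (λ x → minOver (λ s → d x (c s)) ≤ e) code
  code-inj {x} {y} x-near y-near eq with combine-injective (nearest x) _ (nearest y) _ eq
  ... | same , offsets-eq = offset-injective (near x-near) y-near′
          (mod-injective-≤ (offset-≤ (near x-near)) (offset-≤ y-near′)
            (trans offsets-eq (cong (λ s → offset y (c s) mod suc (e + e)) (sym same))))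
    where
    y-near′ : d y (c (nearest x)) ≤ e
    y-near′ = subst (λ s → d y (c s) ≤ e) (sym same) (near y-near)

-- point r is the point at distance r from the left server of a gap of the given length.
record Gap {n k} (f : Fin n → ℕ) (c : Fin k → Fin n) : Set where
  field
    length           : ℕ
    point            : ℕ → Fin n
    point-injective  : ∀ {r s} → r < length → s < length → point r ≡ point s → r ≡ s
    point-not-server : ∀ {r} u → 0 < r → r < length → point r ≢ c u
    level-≤-left     : ∀ {r} → r < length → f (point r) ≤ r
    level-≤-right    : ∀ {r} → r < length → f (point r) + r ≤ length

distinctBelow-++ : ∀ {n v a b} {f : Fin n → ℕ} {g : Fin a → Fin n} {h : Fin b → Fin n} →
  Injective _≡_ _≡_ g × (∀ i → f (g i) < v) → Injective _≡_ _≡_ h × (∀ j → f (h j) < v) →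
  (∀ i j → g i ≢ h j) → DistinctBelow f v (a + b)
distinctBelow-++ {n} {v} {a} {b} {f} {g} {h} (g-inj , g<) (h-inj , h<) disjoint = g ++ h , inj , bound
  where
  bound : ∀ x → f ((g ++ h) x) < v
  bound x with splitAt a x
  ... | inj₁ i = g< i
  ... | inj₂ j = h< j

  [g,h]-inj : ∀ x y → [ g , h ]′ x ≡ [ g , h ]′ y → x ≡ y
  [g,h]-inj (inj₁ i) (inj₁ i′) eq = cong inj₁ (g-inj eq)
  [g,h]-inj (inj₁ i) (inj₂ j)  eq = contradiction eq (disjoint i j)
  [g,h]-inj (inj₂ j) (inj₁ i)  eq = contradiction (sym eq) (disjoint i j)
  [g,h]-inj (inj₂ j) (inj₂ j′) eq = cong inj₂ (h-inj eq)

  inj : Injective _≡_ _≡_ (g ++ h)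
  inj {x} {y} eq = begin
    x                        ≡⟨ join-splitAt a b x ⟨
    F.join a b (splitAt a x) ≡⟨ cong (F.join a b) ([g,h]-inj (splitAt a x) (splitAt a y) eq) ⟩
    F.join a b (splitAt a y) ≡⟨ join-splitAt a b y ⟩
    y                        ∎
    where open ≡-Reasoning

gap-distinctBelow : ∀ {n k} {f : Fin n → ℕ} {c : Fin k → Fin n} → Injective _≡_ _≡_ c →
  (∀ u → f (c u) ≡ 0) → (G : Gap f c) →
  ∀ d → suc d + suc d ≤ Gap.length G → DistinctBelow f (suc d) (k + (d + d))
gap-distinctBelow {n} {k} {f} {c} c-inj server-level G d 2d≤L =
  distinctBelow-++ {f = f} (c-inj , server<) (proj₂ (distinctBelow-++ {f = f} left right left≢right))
    server≢interior
  where
  open Gap G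
  L = length

  d<L∸d : suc d < L ∸ d
  d<L∸d = m+n≤o⇒m≤o∸n (suc (suc d)) (subst (_≤ L) (+-suc (suc d) d) 2d≤L)

  left<right : ∀ (i j : Fin d) → suc (toℕ i) < L ∸ suc (toℕ j)
  left<right i j = <-≤-trans (≤-<-trans (toℕ<n i) (≤-<-trans (n≤1+n d) d<L∸d)) (∸-monoʳ-≤ L (toℕ<n j))

  left-bound : ∀ (j : Fin d) → suc (toℕ j) < L
  left-bound j = <-≤-trans (left<right j j) (m∸n≤m L (suc (toℕ j)))

  right-bound : ∀ (j : Fin d) → L ∸ suc (toℕ j) < L
  right-bound j = ∸-monoʳ-< {n = suc (toℕ j)} z<s (<⇒≤ (left-bound j))

  leftPoint rightPoint : Fin d → Fin n
  leftPoint j = point (suc (toℕ j))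
  rightPoint j = point (L ∸ suc (toℕ j))

  server< : ∀ u → f (c u) < suc d
  server< u = subst (_< suc d) (sym (server-level u)) z<s

  left : Injective _≡_ _≡_ leftPoint × (∀ j → f (leftPoint j) < suc d)
  left = (λ eq → toℕ-injective (suc-injective (point-injective (left-bound _) (left-bound _) eq)))
       , (λ j → s≤s (≤-trans (level-≤-left (left-bound j)) (toℕ<n j)))

  rightPoint-level : ∀ j → f (rightPoint j) ≤ suc (toℕ j)
  rightPoint-level j = subst (f (rightPoint j) ≤_) (m∸[m∸n]≡n (<⇒≤ (left-bound j)))
                         (m+n≤o⇒m≤o∸n _ (level-≤-right (right-bound j)))

  right : Injective _≡_ _≡_ rightPoint × (∀ j → f (rightPoint j) < suc d)
  right = (λ eq → toℕ-injective (suc-injective (∸-cancelˡ-≡ (<⇒≤ (left-bound _)) (<⇒≤ (left-bound _))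
                    (point-injective (right-bound _) (right-bound _) eq))))
        , (λ j → s≤s (≤-trans (rightPoint-level j) (toℕ<n j)))

  left≢right : ∀ i j → leftPoint i ≢ rightPoint j
  left≢right i j eq = <⇒≢ (left<right i j) (point-injective (left-bound i) (right-bound j) eq)

  server≢interior : ∀ u j → c u ≢ (leftPoint ++ rightPoint) j
  server≢interior u j with splitAt d j
  ... | inj₁ i = λ eq → point-not-server u z<s (left-bound i) (sym eq)
  ... | inj₂ i = λ eq → point-not-server u (m<n⇒0<n∸m (left-bound i)) (right-bound i) (sym eq)

dist-self : ∀ sp N x → dist sp N x x ≡ 0
dist-self line   N x = ∣n-n∣≡0 (toℕ x)
dist-self circle N x rewrite ∣n-n∣≡0 (toℕ x) = refl

Dmin-server : ∀ sp {N k′} (C : Config sp N (suc k′)) u → Dmin sp N k′ C (proj₁ C u) ≡ 0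
Dmin-server sp {N} (c , _) u =
  n≤0⇒n≡0 (≤-trans (minOver-≤ (λ s → dist sp N (c u) (c s)) u) (≤-reflexive (dist-self sp N (c u))))

Dmin-≤-dist : ∀ sp {N k′} (C : Config sp N (suc k′)) p s → Dmin sp N k′ C p ≤ dist sp N p (proj₁ C s)
Dmin-≤-dist sp (c , _) p s = minOver-≤ _ s

∣-∣≤⇒≤+ : ∀ {m n e} → ∣ m - n ∣ ≤ e → m ≤ n + e
∣-∣≤⇒≤+ {m} {n} h = ≤-trans (m≤n+∣m-n∣ m n) (+-monoʳ-≤ n h)

line-ballCoordinate : ∀ N e → BallCoordinate (dist line N) e
line-ballCoordinate N e = record
  { offset           = λ x y → toℕ x + e ∸ toℕ y
  ; offset-≤         = λ {x} {y} → offset-≤ {x} {y}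
  ; offset-injective = λ {x} {x′} {y} → offset-injective {x} {x′} {y}
  }
  where
  offset-≤ : ∀ {x y} → dist line N x y ≤ e → toℕ x + e ∸ toℕ y ≤ e + e
  offset-≤ {x} {y} h = subst (toℕ x + e ∸ toℕ y ≤_) (m+n∸m≡n (toℕ y) (e + e))
    (∸-monoˡ-≤ (toℕ y) (subst (toℕ x + e ≤_) (+-assoc (toℕ y) e e) (+-monoˡ-≤ e (∣-∣≤⇒≤+ h))))

  offset-injective : ∀ {x x′ y} → dist line N x y ≤ e → dist line N x′ y ≤ e →
    toℕ x + e ∸ toℕ y ≡ toℕ x′ + e ∸ toℕ y → x ≡ x′
  offset-injective {x} {x′} {y} h h′ eq = toℕ-injective (+-cancelʳ-≡ e _ _ (begin
    toℕ x + e                    ≡⟨ m∸n+n≡m (y≤ h) ⟨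
    toℕ x + e ∸ toℕ y + toℕ y    ≡⟨ cong (_+ toℕ y) eq ⟩
    toℕ x′ + e ∸ toℕ y + toℕ y   ≡⟨ m∸n+n≡m (y≤ h′) ⟩
    toℕ x′ + e                   ∎))
    where
    open ≡-Reasoning
    y≤ : ∀ {z} → dist line N z y ≤ e → toℕ y ≤ toℕ z + e
    y≤ {z} h = ∣-∣≤⇒≤+ (subst (_≤ e) (∣-∣-comm (toℕ z) (toℕ y)) h)

line-distinctBelow : ∀ {N k′} (C : Config line N (suc k′)) {p} → Between line N (suc k′) C p →
  ∀ d → Dmin line N k′ C p ≡ suc d → DistinctBelow (Dmin line N k′ C) (suc d) (suc k′ + (d + d))
line-distinctBelow {N} {k′} C@(c , c-inj) {p} (s , t , a<b , no-server-between , a≤p , p≤b) d level =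
  gap-distinctBelow c-inj (Dmin-server line C) gap d 2d≤L
  where
  a = toℕ (c s)
  b = toℕ (c t)
  L = b ∸ a

  point : ℕ → Fin (suc N)
  point r = (a + r) mod suc N

  a+r<b : ∀ {r} → r < L → a + r < b
  a+r<b {r} r<L = subst (a + r <_) (m+[n∸m]≡n (<⇒≤ a<b)) (+-monoʳ-< a r<L)

  toℕ-point : ∀ {r} → r < L → toℕ (point r) ≡ a + r
  toℕ-point {r} r<L = trans (toℕ-fromℕ< (m%n<n (a + r) (suc N)))
                            (m≤n⇒m%n≡m (≤-trans (<⇒≤ (a+r<b r<L)) (s≤s⁻¹ (toℕ<n (c t)))))

  gap : Gap (Dmin line N k′ C) c
  gap = record
    { length           = L
    ; point            = point
    ; point-injective  = λ r<L s<L eq →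
        +-cancelˡ-≡ a _ _ (trans (sym (toℕ-point r<L)) (trans (cong toℕ eq) (toℕ-point s<L)))
    ; point-not-server = λ {r} u 0<r r<L eq →
        let a+r≡cu = trans (sym (toℕ-point r<L)) (cong toℕ eq)
        in no-server-between (u , subst (a <_) a+r≡cu (m<m+n a 0<r) , subst (_< b) a+r≡cu (a+r<b r<L))
    ; level-≤-left     = λ {r} r<L → ≤-trans (Dmin-≤-dist line C (point r) s) (≤-reflexive (begin
        ∣ toℕ (point r) - a ∣ ≡⟨ cong ∣_- a ∣ (toℕ-point r<L) ⟩
        ∣ a + r - a ∣         ≡⟨ ∣-∣-comm (a + r) a ⟩
        ∣ a - a + r ∣         ≡⟨ ∣m-m+n∣≡n a r ⟩
        r                     ∎))
    ; level-≤-right    = λ {r} r<L → ≤-trans (+-monoˡ-≤ r (Dmin-≤-dist line C (point r) t)) (≤-reflexive (begin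
        ∣ toℕ (point r) - b ∣ + r ≡⟨ cong (λ x → ∣ x - b ∣ + r) (toℕ-point r<L) ⟩
        ∣ a + r - b ∣ + r         ≡⟨ cong (_+ r) (m≤n⇒∣m-n∣≡n∸m (<⇒≤ (a+r<b r<L))) ⟩
        b ∸ (a + r) + r           ≡⟨ cong (_+ r) (∸-+-assoc b a r) ⟨
        L ∸ r + r                 ≡⟨ m∸n+n≡m (<⇒≤ r<L) ⟩
        L                         ∎))
    }
    where open ≡-Reasoning

  2d≤L : suc d + suc d ≤ L
  2d≤L = begin
    suc d + suc d                 ≤⟨ +-mono-≤ (d<dist t) (d<dist s) ⟩
    ∣ toℕ p - b ∣ + ∣ toℕ p - a ∣ ≡⟨ cong₂ _+_ (m≤n⇒∣m-n∣≡n∸m p≤b) (m≤n⇒∣n-m∣≡n∸m a≤p) ⟩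
    (b ∸ toℕ p) + (toℕ p ∸ a)     ≡⟨ +-∸-assoc (b ∸ toℕ p) a≤p ⟨
    (b ∸ toℕ p) + toℕ p ∸ a       ≡⟨ cong (_∸ a) (m∸n+n≡m p≤b) ⟩
    L                             ∎
    where
    open ≤-Reasoning
    d<dist : ∀ s → suc d ≤ dist line N p (c s)
    d<dist s = subst (_≤ dist line N p (c s)) level (Dmin-≤-dist line C p s)

module _ {N : ℕ} .{{_ : NonZero N}} where

  %-absorbˡ : ∀ m n → (m % N + n) % N ≡ (m + n) % N
  %-absorbˡ m n = begin
    (m % N + n) % N         ≡⟨ %-distribˡ-+ (m % N) n N ⟩
    (m % N % N + n % N) % N ≡⟨ cong (λ x → (x + n % N) % N) (m%n%n≡m%n m N) ⟩
    (m % N + n % N) % N     ≡⟨ %-distribˡ-+ m n N ⟨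
    (m + n) % N             ∎
    where open ≡-Reasoning

  %-absorbʳ : ∀ m n → (m + n % N) % N ≡ (m + n) % N
  %-absorbʳ m n = begin
    (m + n % N) % N ≡⟨ cong (_% N) (+-comm m (n % N)) ⟩
    (n % N + m) % N ≡⟨ %-absorbˡ n m ⟩
    (n + m) % N     ≡⟨ cong (_% N) (+-comm n m) ⟩
    (m + n) % N     ∎
    where open ≡-Reasoning

  %-rotate-back : ∀ {a x} → a ≤ N → x < N → ((a + x) % N + (N ∸ a)) % N ≡ x
  %-rotate-back {a} {x} a≤N x<N = begin
    ((a + x) % N + (N ∸ a)) % N ≡⟨ %-absorbˡ (a + x) (N ∸ a) ⟩
    (a + x + (N ∸ a)) % N       ≡⟨ cong (_% N) (trans (+-assoc a x (N ∸ a)) (+-comm a (x + (N ∸ a)))) ⟩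
    (x + (N ∸ a) + a) % N       ≡⟨ cong (_% N) (trans (+-assoc x (N ∸ a) a) (cong (x +_) (m∸n+n≡m a≤N))) ⟩
    (x + N) % N                 ≡⟨ [m+n]%n≡m%n x N ⟩
    x % N                       ≡⟨ m<n⇒m%n≡m x<N ⟩
    x                           ∎
    where open ≡-Reasoning

  +-%-cancelˡ : ∀ a {x y} → x < N → y < N → (a + x) % N ≡ (a + y) % N → x ≡ y
  +-%-cancelˡ a {x} {y} x<N y<N eq = begin
    x                                       ≡⟨ %-rotate-back a′≤N x<N ⟨
    ((a′ + x) % N + (N ∸ a′)) % N           ≡⟨ cong (λ z → (z + (N ∸ a′)) % N) eq′ ⟩
    ((a′ + y) % N + (N ∸ a′)) % N           ≡⟨ %-rotate-back a′≤N y<N ⟩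
    y                                       ∎
    where
    open ≡-Reasoning
    a′ = a % N
    a′≤N : a′ ≤ N
    a′≤N = m%n≤n a N
    eq′ : (a′ + x) % N ≡ (a′ + y) % N
    eq′ = trans (%-absorbˡ a x) (trans eq (sym (%-absorbˡ a y)))

  %-cases : ∀ {m} → m < N + N → m % N ≡ m ⊎ m % N + N ≡ m
  %-cases {m} m<2N with m <? N
  ... | yes m<N = inj₁ (m<n⇒m%n≡m m<N)
  ... | no m≮N = inj₂ (begin
    m % N + N           ≡⟨ cong (λ z → z % N + N) (m∸n+n≡m N≤m) ⟨
    (m ∸ N + N) % N + N ≡⟨ cong (_+ N) ([m+n]%n≡m%n (m ∸ N) N) ⟩
    (m ∸ N) % N + N     ≡⟨ cong (_+ N) (m<n⇒m%n≡m m∸N<N) ⟩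
    m ∸ N + N           ≡⟨ m∸n+n≡m N≤m ⟩
    m                   ∎)
    where
    open ≡-Reasoning
    N≤m : N ≤ m
    N≤m = ≮⇒≥ m≮N
    m∸N<N : m ∸ N < N
    m∸N<N = +-cancelʳ-< N (m ∸ N) N (subst (_< N + N) (sym (m∸n+n≡m N≤m)) m<2N)

  ∸-≤-N : ∀ (a b : Fin N) → toℕ a ∸ toℕ b ≤ N
  ∸-≤-N a b = ≤-trans (m∸n≤m (toℕ a) (toℕ b)) (<⇒≤ (toℕ<n a))

  cw-spec : ∀ (a b : Fin N) → (toℕ a + cw N a b) % N ≡ toℕ b
  cw-spec a b with toℕ a ≤ᵇ toℕ b | ≤ᵇ-reflects-≤ (toℕ a) (toℕ b)
  ... | true  | ofʸ a≤b = trans (cong (_% N) (m+[n∸m]≡n a≤b)) (m<n⇒m%n≡m (toℕ<n b))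
  ... | false | ofⁿ a≰b = trans (cong (_% N) wrap) (trans ([m+n]%n≡m%n (toℕ b) N) (m<n⇒m%n≡m (toℕ<n b)))
    where
    open ≡-Reasoning
    δ = toℕ a ∸ toℕ b
    wrap : toℕ a + (N ∸ δ) ≡ toℕ b + N
    wrap = begin
      toℕ a + (N ∸ δ)         ≡⟨ cong (_+ (N ∸ δ)) (m+[n∸m]≡n (<⇒≤ (≰⇒> a≰b))) ⟨
      toℕ b + δ + (N ∸ δ)     ≡⟨ +-assoc (toℕ b) δ (N ∸ δ) ⟩
      toℕ b + (δ + (N ∸ δ))   ≡⟨ cong (toℕ b +_) (m+[n∸m]≡n (∸-≤-N a b)) ⟩
      toℕ b + N               ∎

  cw<N : ∀ (a b : Fin N) → cw N a b < N
  cw<N a b with toℕ a ≤ᵇ toℕ b | ≤ᵇ-reflects-≤ (toℕ a) (toℕ b)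
  ... | true  | ofʸ _   = ≤-<-trans (m∸n≤m (toℕ b) (toℕ a)) (toℕ<n b)
  ... | false | ofⁿ a≰b = ∸-monoʳ-< (m<n⇒0<n∸m (≰⇒> a≰b)) (∸-≤-N a b)

  circle-dist-cw : ∀ (x y : Fin N) → dist circle N x y ≡ cw N y x ⊓ (N ∸ cw N y x)
  circle-dist-cw x y with toℕ y ≤ᵇ toℕ x | ≤ᵇ-reflects-≤ (toℕ y) (toℕ x)
  ... | true  | ofʸ y≤x rewrite m≤n⇒∣n-m∣≡n∸m y≤x = refl
  ... | false | ofⁿ y≰x
    rewrite m≤n⇒∣m-n∣≡n∸m (<⇒≤ (≰⇒> y≰x))
          | m∸[m∸n]≡n {N} {toℕ y ∸ toℕ x} (∸-≤-N y x)
          = ⊓-comm _ _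

  cw-unique : ∀ (a b : Fin N) {u} → u < N → (toℕ a + u) % N ≡ toℕ b → cw N a b ≡ u
  cw-unique a b u<N eq = +-%-cancelˡ (toℕ a) (cw<N a b) u<N (trans (cw-spec a b) (sym eq))

  cw-injective : ∀ (a : Fin N) {b b′} → cw N a b ≡ cw N a b′ → b ≡ b′
  cw-injective a {b} {b′} eq =
    toℕ-injective (trans (sym (cw-spec a b)) (trans (cong (λ u → (toℕ a + u) % N) eq) (cw-spec a b′)))

  cw-+ : ∀ (a y b : Fin N) → cw N a y + cw N y b ≡ cw N a b ⊎ cw N a y + cw N y b ≡ cw N a b + N
  cw-+ a y b = Sum.map (λ eq → trans (sym eq) s%N≡cw) (λ eq → trans (sym eq) (cong (_+ N) s%N≡cw))
                       (%-cases (+-mono-< (cw<N a y) (cw<N y b)))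
    where
    open ≡-Reasoning
    s = cw N a y + cw N y b
    s%N≡cw : s % N ≡ cw N a b
    s%N≡cw = sym (cw-unique a b (m%n<n s N) (begin
      (toℕ a + s % N) % N                     ≡⟨ %-absorbʳ (toℕ a) s ⟩
      (toℕ a + s) % N                         ≡⟨ cong (_% N) (+-assoc (toℕ a) (cw N a y) (cw N y b)) ⟨
      (toℕ a + cw N a y + cw N y b) % N       ≡⟨ %-absorbˡ (toℕ a + cw N a y) (cw N y b) ⟨
      ((toℕ a + cw N a y) % N + cw N y b) % N ≡⟨ cong (λ z → (z + cw N y b) % N) (cw-spec a y) ⟩
      (toℕ y + cw N y b) % N                  ≡⟨ cw-spec y b ⟩
      toℕ b                                   ∎))

  arcLen-cases : ∀ (a b : Fin N) → (cw N a b ≡ 0 × arcLen N a b ≡ N) ⊎ arcLen N a b ≡ cw N a b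
  arcLen-cases a b with cw N a b
  ... | zero  = inj₁ (refl , refl)
  ... | suc _ = inj₂ refl

  arcLen-≤ : ∀ (a b : Fin N) → arcLen N a b ≤ N
  arcLen-≤ a b with arcLen-cases a b
  ... | inj₁ (_ , full) = ≤-reflexive full
  ... | inj₂ arc≡cw    = subst (_≤ N) (sym arc≡cw) (<⇒≤ (cw<N a b))

  cw-+-≤-arcLen : ∀ (a y b : Fin N) → cw N a y ≤ arcLen N a b → cw N a y + cw N y b ≤ arcLen N a b
  cw-+-≤-arcLen a y b y-on-arc with arcLen-cases a b | cw-+ a y b
  ... | inj₁ (cw≡0 , full) | inj₁ eq =
    subst (cw N a y + cw N y b ≤_) (sym full) (subst (_≤ N) (sym (trans eq cw≡0)) z≤n)
  ... | inj₁ (cw≡0 , full) | inj₂ eq = ≤-reflexive (trans eq (trans (cong (_+ N) cw≡0) (sym full)))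
  ... | inj₂ arc≡cw        | inj₁ eq = ≤-reflexive (trans eq (sym arc≡cw))
  ... | inj₂ arc≡cw        | inj₂ eq =
    contradiction eq (<⇒≢ (+-mono-≤-< (subst (cw N a y ≤_) arc≡cw y-on-arc) (cw<N y b)))

  dist-≤-cw : ∀ (x y : Fin N) → dist circle N x y ≤ cw N y x
  dist-≤-cw x y = subst (_≤ cw N y x) (sym (circle-dist-cw x y)) (m⊓n≤m _ _)

  dist-≤-cw′ : ∀ (x y : Fin N) → dist circle N x y ≤ cw N x y
  dist-≤-cw′ x y =
    subst (_≤ cw N x y) (cong (λ δ → δ ⊓ (N ∸ δ)) (∣-∣-comm (toℕ y) (toℕ x))) (dist-≤-cw y x)

  Dmin-≤-cw : ∀ {k′} (C : Config circle N (suc k′)) p s → Dmin circle N k′ C p ≤ cw N (proj₁ C s) p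
  Dmin-≤-cw C p s = ≤-trans (Dmin-≤-dist circle C p s) (dist-≤-cw p (proj₁ C s))

  Dmin-≤-cw′ : ∀ {k′} (C : Config circle N (suc k′)) p s → Dmin circle N k′ C p ≤ cw N p (proj₁ C s)
  Dmin-≤-cw′ C p s = ≤-trans (Dmin-≤-dist circle C p s) (dist-≤-cw′ p (proj₁ C s))

  [e+u]%N≤e : ∀ {e u} → u ≤ N → N ∸ u ≤ e → (e + u) % N ≤ e
  [e+u]%N≤e {e} {u} u≤N w≤e = begin
    (e + u) % N               ≡⟨ cong (λ z → (z + u) % N) (m∸n+n≡m w≤e) ⟨
    (e ∸ w + w + u) % N       ≡⟨ cong (_% N) (+-assoc (e ∸ w) w u) ⟩
    (e ∸ w + (w + u)) % N     ≡⟨ cong (λ z → (e ∸ w + z) % N) (m∸n+n≡m u≤N) ⟩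
    (e ∸ w + N) % N           ≡⟨ [m+n]%n≡m%n (e ∸ w) N ⟩
    (e ∸ w) % N               ≤⟨ m%n≤m (e ∸ w) N ⟩
    e ∸ w                     ≤⟨ m∸n≤m e w ⟩
    e                         ∎
    where
    open ≤-Reasoning
    w = N ∸ u

  -- (e + cw y x) % N is the clockwise distance to x from the point e steps before y.
  circle-ballCoordinate : ∀ e → BallCoordinate (dist circle N) e
  circle-ballCoordinate e = record
    { offset           = offset
    ; offset-≤         = λ {x} {y} → offset-≤ {x} {y}
    ; offset-injective = λ {x} {x′} {y} _ _ eq → cw-injective y (+-%-cancelˡ e (cw<N y x) (cw<N y x′) eq)
    }
    where
    offset : Fin N → Fin N → ℕ
    offset x y = (e + cw N y x) % N

    offset-≤ : ∀ {x y} → dist circle N x y ≤ e → offset x y ≤ e + e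
    offset-≤ {x} {y} h with ⊓-sel (cw N y x) (N ∸ cw N y x)
    ... | inj₁ eq = ≤-trans (m%n≤m (e + cw N y x) N)
                      (+-monoʳ-≤ e (subst (_≤ e) (trans (circle-dist-cw x y) eq) h))
    ... | inj₂ eq = ≤-trans ([e+u]%N≤e (<⇒≤ (cw<N y x)) (subst (_≤ e) (trans (circle-dist-cw x y) eq) h))
                      (m≤m+n e e)

  circle-distinctBelow : ∀ {k′} (C : Config circle N (suc k′)) {p} → Between circle N (suc k′) C p →
    ∀ d → Dmin circle N k′ C p ≡ suc d → DistinctBelow (Dmin circle N k′ C) (suc d) (suc k′ + (d + d))
  circle-distinctBelow {k′} C@(c , c-inj) {p} (s , t , no-server-on-arc , p-on-arc) d level =
    gap-distinctBelow c-inj (Dmin-server circle C) gap d 2d≤L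
    where
    L = arcLen N (c s) (c t)

    point : ℕ → Fin N
    point r = (toℕ (c s) + r) mod N

    cw-point : ∀ {r} → r < L → cw N (c s) (point r) ≡ r
    cw-point r<L = cw-unique (c s) _ (<-≤-trans r<L (arcLen-≤ (c s) (c t))) (sym (toℕ-fromℕ< _))

    level-≤-right : ∀ {r} → r < L → Dmin circle N k′ C (point r) + r ≤ L
    level-≤-right {r} r<L = begin
      Dmin circle N k′ C (point r) + r            ≤⟨ +-monoˡ-≤ r (Dmin-≤-cw′ C (point r) t) ⟩
      cw N (point r) (c t) + r                    ≡⟨ +-comm _ r ⟩
      r + cw N (point r) (c t)                    ≡⟨ cong (_+ cw N (point r) (c t)) (cw-point r<L) ⟨
      cw N (c s) (point r) + cw N (point r) (c t) ≤⟨ cw-+-≤-arcLen (c s) (point r) (c t) on-arc ⟩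
      L                                           ∎
      where
      open ≤-Reasoning
      on-arc : cw N (c s) (point r) ≤ L
      on-arc = subst (_≤ L) (sym (cw-point r<L)) (<⇒≤ r<L)

    gap : Gap (Dmin circle N k′ C) c
    gap = record
      { length           = L
      ; point            = point
      ; point-injective  = λ r<L r′<L eq →
          trans (sym (cw-point r<L)) (trans (cong (cw N (c s)) eq) (cw-point r′<L))
      ; point-not-server = λ u 0<r r<L eq →
          let r≡cw = trans (sym (cw-point r<L)) (cong (cw N (c s)) eq)
          in no-server-on-arc (u , subst (0 <_) r≡cw 0<r , subst (_< L) r≡cw r<L)
      ; level-≤-left     = λ {r} r<L →
          subst (Dmin circle N k′ C (point r) ≤_) (cw-point r<L) (Dmin-≤-cw C (point r) s)
      ; level-≤-right    = level-≤-right
      }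

    2d≤L : suc d + suc d ≤ L
    2d≤L = begin
      suc d + suc d                  ≤⟨ +-mono-≤ (subst (_≤ _) level (Dmin-≤-cw C p s))
                                                 (subst (_≤ _) level (Dmin-≤-cw′ C p t)) ⟩
      cw N (c s) p + cw N p (c t)    ≤⟨ cw-+-≤-arcLen (c s) p (c t) p-on-arc ⟩
      L                              ∎
      where open ≤-Reasoning

Dmin-sublevelInjection : ∀ sp {N} .{{_ : NonZero N}} {k′} (C : Config sp N (suc k′)) e →
  SublevelInjection (Dmin sp N k′ C) e (suc k′ * suc (e + e))
Dmin-sublevelInjection line   C e = nearest-sublevelInjection (line-ballCoordinate _ e) (proj₁ C)
Dmin-sublevelInjection circle C e = nearest-sublevelInjection (circle-ballCoordinate e) (proj₁ C)

between-distinctBelow : ∀ sp {N} .{{_ : NonZero N}} {k′} (C : Config sp N (suc k′)) {p} →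
  Between sp N (suc k′) C p →
  ∀ d → Dmin sp N k′ C p ≡ suc d → DistinctBelow (Dmin sp N k′ C) (suc d) (suc k′ + (d + d))
between-distinctBelow line   = line-distinctBelow
between-distinctBelow circle = circle-distinctBelow

lemma8 : (sp : Space) (k' m' : ℕ)
         (C₁ C₂ : Config sp (gridN k' m') (suc k'))
         (σ₁ σ₂ : Fin (numPts sp (gridN k' m')) → Fin (numPts sp (gridN k' m'))) →
         IsOrdering sp (gridN k' m') k' C₁ σ₁ → IsOrdering sp (gridN k' m') k' C₂ σ₂ →
         (i : Fin (numPts sp (gridN k' m'))) →
         Between sp (gridN k' m') (suc k') C₁ (σ₁ i) →
         Dmin sp (gridN k' m') k' C₁ (σ₁ i) ≤ suc k' * Dmin sp (gridN k' m') k' C₂ (σ₂ i)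
lemma8 sp k' m' C₁ C₂ σ₁ σ₂ ((_ , σ₁-surj) , sorted₁) ((σ₂-inj , _) , sorted₂) i between =
  rank-bound {k = suc k'} {f₁ = Dmin sp N k' C₁} {f₂ = Dmin sp N k' C₂} σ₁-surj sorted₁ σ₂-inj sorted₂
    (Dmin-sublevelInjection sp C₂) i (between-distinctBelow sp C₁ between)
  where N = gridN k' m'
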